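{- The class of all irreflexive symmetric frames with at least $2$ elements is relatively elementary definable in $\mathcal{L}_2$.
   Context: A frame is a pair $(W,R)$ with $W$ non-empty and $R\subseteq W\times W$. For sets $A,B$ with $A\cap B=\emptyset$, $A\cup B\neq\emptyset$, and a function $\rho:A\to\mathcal{P}(B)$, the galaxy $\mathcal{F}^\rho_{A,B}$ is the frame with universe $A\cup B$ and relation $\bigcup_{s\in A}(\{s\}\times\rho(s))\cup(B\times B)$. $\mathcal{L}_2$ is the class of all galaxies $\mathcal{F}^\rho_{A,B}$ with $|A|\geq4$, $|B|\geq4$ and $|B\setminus\rho(s)|=2$ for all $s\in A$. First-order formulas use equality and one binary relation symbol $\mathbf{R}$. A class $\mathcal{C}$ of frames is relatively elementary definable in a class $\mathcal{C}'$ of frames if there are first-order formulas $\mathbf{U}(\mathbf{x_1},\mathbf{x_2})$, $\mathbf{E}(\mathbf{x_1},\mathbf{x_2},\mathbf{y_1},\mathbf{y_2})$ and $\mathbf{A}(\mathbf{x_1},\mathbf{x_2},\mathbf{y_1},\mathbf{y_2})$ such that for every frame $(W,R)$ in $\mathcal{C}$ there is a frame $(W',R')$ in $\mathcal{C}'$ such that, letting $X=\{(s_1,s_2)\in W'^2:(W',R')\models\mathbf{U}[s_1,s_2]\}$, $\eta=\{((s_1,s_2),(t_1,t_2))\in X^2:(W',R')\models\mathbf{E}[s_1,s_2,t_1,t_2]\}$ and $S=\{((s_1,s_2),(t_1,t_2))\in X^2:(W',R')\models\mathbf{A}[s_1,s_2,t_1,t_2]\}$: $X$ is non-empty, $\eta$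 is an equivalence relation on $X$ which is a congruence for $S$ (i.e. if $a\,\eta\, c$ and $b\,\eta\, d$ then $aSb$ iff $cSd$), and the quotient $(X,S)/\eta$ is isomorphic to $(W,R)$. -}

module Defs where

open import Level using (0ℓ)
open import Data.Nat using (ℕ; suc)
open import Data.Fin using (Fin; zero; suc)
open import Data.Empty using (⊥)
open import Data.Unit using (⊤)
open import Data.Sum using (_⊎_; inj₁; inj₂)
open import Data.Product using (Σ; Σ-syntax; _×_; _,_)
open import Relation.Nullary using (¬_)
open import Relation.Binary.PropositionalEquality using (_≡_; _≢_)
open import Relation.Binary.Structures using (IsEquivalence)
open import Function.Bundles using (_⇔_; _↣_)

record Frame : Set₁ where
  constructor frame
  field
    W        : Set
    R        : W → W → Set
    inhabited : W

open Frame public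

IrrSym2 : Frame → Set
IrrSym2 F =
  (∀ x → ¬ R F x x) ×
  (∀ x y → R F x y → R F y x) ×
  (Σ[ x ∈ W F ] Σ[ y ∈ W F ] x ≢ y)

-- Galaxies.  The universe A ∪ B with A ∩ B = ∅ is the disjoint union
-- A ⊎ B; ρ : A → P(B) is a predicate ρ s b meaning b ∈ ρ(s).

galaxyRel : (A B : Set) → (A → B → Set) → A ⊎ B → A ⊎ B → Set
galaxyRel A B ρ (inj₁ s) (inj₁ t) = ⊥
galaxyRel A B ρ (inj₁ s) (inj₂ b) = ρ s b
galaxyRel A B ρ (inj₂ b) (inj₁ t) = ⊥
galaxyRel A B ρ (inj₂ b) (inj₂ c) = ⊤

galaxy : (A B : Set) → (A → B → Set) → (A ⊎ B) → Frame
galaxy A B ρ w = frame (A ⊎ B) (galaxyRel A B ρ) w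

ComplementHasTwo : (B : Set) → (B → Set) → Set
ComplementHasTwo B X =
  Σ[ b₁ ∈ B ] Σ[ b₂ ∈ B ]
    (b₁ ≢ b₂) × ¬ X b₁ × ¬ X b₂ ×
    (∀ b → ¬ X b → (b ≡ b₁) ⊎ (b ≡ b₂))

-- Membership in L₂: the frame is (literally) a galaxy F^ρ_{A,B} with
-- |A| ≥ 4, |B| ≥ 4 and |B ∖ ρ(s)| = 2 for every s ∈ A.
L2 : Frame → Set₁
L2 F =
  Σ[ A ∈ Set ] Σ[ B ∈ Set ] Σ[ ρ ∈ (A → B → Set) ] Σ[ w ∈ A ⊎ B ]
    (Fin 4 ↣ A) × (Fin 4 ↣ B) ×
    (∀ s → ComplementHasTwo B (ρ s)) ×
    (F ≡ galaxy A B ρ w)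

data Fm (n : ℕ) : Set where
  _≐_  : Fin n → Fin n → Fm n
  rel  : Fin n → Fin n → Fm n
  ff   : Fm n
  _⇒_  : Fm n → Fm n → Fm n
  _∧_  : Fm n → Fm n → Fm n
  _∨_  : Fm n → Fm n → Fm n
  ∀'   : Fm (suc n) → Fm n
  ∃'   : Fm (suc n) → Fm n

_▸_ : {n : ℕ} {W : Set} → W → (Fin n → W) → Fin (suc n) → W
(x ▸ e) zero    = x
(x ▸ e) (suc i) = e i

-- Satisfaction (Tarskian; classical once excluded middle is assumed)
Sat : (F : Frame) {n : ℕ} → (Fin n → W F) → Fm n → Set
Sat F e (i ≐ j)  = e i ≡ e j
Sat F e (rel i j) = R F (e i) (e j)
Sat F e ff        = ⊥
Sat F e (φ ⇒ ψ)   = Sat F e φ → Sat F e ψ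
Sat F e (φ ∧ ψ)   = Sat F e φ × Sat F e ψ
Sat F e (φ ∨ ψ)   = Sat F e φ ⊎ Sat F e ψ
Sat F e (∀' φ)    = (x : W F) → Sat F (x ▸ e) φ
Sat F e (∃' φ)    = Σ[ x ∈ W F ] Sat F (x ▸ e) φ

env2 : {W : Set} → W → W → Fin 2 → W
env2 a b zero       = a
env2 a b (suc zero) = b

env4 : {W : Set} → W → W → W → W → Fin 4 → W
env4 a b c d zero                   = a
env4 a b c d (suc zero)             = b
env4 a b c d (suc (suc zero))       = c
env4 a b c d (suc (suc (suc zero))) = d

module Interp (F' : Frame) (U : Fm 2) (E A : Fm 4) where
  X : Set
  X = Σ[ s ∈ W F' × W F' ] Sat F' (env2 (Data.Product.proj₁ s) (Data.Product.proj₂ s)) U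

  pr : X → W F' × W F'
  pr (s , _) = s

  E4 : Fm 4 → X → X → Set
  E4 φ ((s₁ , s₂) , _) ((t₁ , t₂) , _) = Sat F' (env4 s₁ s₂ t₁ t₂) φ

  η : X → X → Set
  η = E4 E

  S : X → X → Set
  S = E4 A

-- (X,S)/η ≅ (W,R): a map f : X → W whose kernel is exactly η,
-- which is surjective and satisfies  S a b ⇔ R (f a) (f b).
QuotientIso : (X : Set) (η S : X → X → Set) (F : Frame) → Set
QuotientIso X η S F =
  Σ[ f ∈ (X → W F) ]
    (∀ a b → η a b ⇔ (f a ≡ f b)) ×
    (∀ w → Σ[ a ∈ X ] f a ≡ w) ×
    (∀ a b → S a b ⇔ R F (f a) (f b))

GoodInterp : (F' : Frame) (U : Fm 2) (E A : Fm 4) (F : Frame) → Set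
GoodInterp F' U E A F =
  X ×
  IsEquivalence η ×
  (∀ a b c d → η a c → η b d → S a b ⇔ S c d) ×
  QuotientIso X η S F
  where open Interp F' U E A

RelElemDefinable : (Frame → Set) → (Frame → Set₁) → Set₁
RelElemDefinable C C' =
  Σ[ U ∈ Fm 2 ] Σ[ E ∈ Fm 4 ] Σ[ A ∈ Fm 4 ]
    ((F : Frame) → C F →
      Σ[ F' ∈ Frame ] C' F' × GoodInterp F' U E A F)

{-# OPTIONS --safe #-}

-- Encode an irreflexive symmetric frame (W, R) as a galaxy whose core B is W
-- together with two new points, the apex and the base, and in which every
-- satellite misses exactly two core points: a copy of w misses w and the
-- apex, a satellite for each edge a R b misses a and b, and two extra
-- satellites miss the apex and the base.  The apex is the only core point
-- sharing a non-neighbour with every point, so it is definable.  A point x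
-- is then a vertex iff exactly one satellite misses both x and the apex
-- (namely the copy of x; the two extras miss the apex together with every
-- non-vertex), and two distinct vertices are R-related iff some satellite
-- misses both.

module Submission where

open import Defs
open import Level using (0ℓ)
open import Axiom.ExcludedMiddle using (ExcludedMiddle)
open import Axiom.DoubleNegationElimination using (DoubleNegationElimination; em⇒dne)
open import Data.Nat using (suc)
open import Data.Fin using (Fin; zero; suc)
open import Data.Fin.Properties using (+↔⊎)
open import Data.Empty using (⊥; ⊥-elim)
open import Data.Unit using (tt)
open import Data.Sum using (_⊎_; inj₁; inj₂)
open import Data.Sum.Properties using (inj₁-injective)
open import Data.Sum.Function.Propositional using (_⊎-↣_)
open import Data.Product using (Σ-syntax; _×_; _,_; proj₁; proj₂)
open import Relation.Nullary using (¬_)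
open import Relation.Binary.PropositionalEquality
  using (_≡_; _≢_; refl; sym; trans; cong; cong₂)
open import Relation.Binary.Structures using (IsEquivalence)
open import Function.Base using (case_of_)
open import Function.Bundles using (_⇔_; _↣_; mk↣; mk⇔; module Equivalence)
open import Function.Construct.Composition using (_↣-∘_)
open import Function.Construct.Identity using (↣-id)
open import Function.Properties.Equivalence using (⇔-setoid)
open import Function.Properties.Inverse using (↔⇒↣)

open Equivalence using (to; from)

quotientIso⇒goodInterp : ∀ F' U E A F →
  let open Interp F' U E A in QuotientIso X η S F → GoodInterp F' U E A F
quotientIso⇒goodInterp F' U E A F iso@(f , kernel , surjective , homomorphic) =
  proj₁ (surjective (inhabited F)) , η-isEquivalence , η-congruence , iso
  where
  open Interp F' U E A

  η-isEquivalence : IsEquivalence η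
  η-isEquivalence = record
    { refl  = λ {a} → from (kernel a a) refl
    ; sym   = λ {a} {b} a~b → from (kernel b a) (sym (to (kernel a b) a~b))
    ; trans = λ {a} {b} {c} a~b b~c →
        from (kernel a c) (trans (to (kernel a b) a~b) (to (kernel b c) b~c))
    }

  η-congruence : ∀ a b c d → η a c → η b d → S a b ⇔ S c d
  η-congruence a b c d a~c b~d = begin
    S a b                ≈⟨ homomorphic a b ⟩
    R F (f a) (f b)      ≡⟨ cong₂ (R F) (to (kernel a c) a~c) (to (kernel b d) b~d) ⟩
    R F (f c) (f d)      ≈⟨ homomorphic c d ⟨
    S c d                ∎
    where open import Relation.Binary.Reasoning.Setoid (⇔-setoid 0ℓ)

_∈₂_ : {B : Set} → B → B × B → Set
b ∈₂ (b₁ , b₂) = b ≡ b₁ ⊎ b ≡ b₂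

complementOfPair : DoubleNegationElimination 0ℓ → {B : Set} {b₁ b₂ : B} →
  b₁ ≢ b₂ → ComplementHasTwo B (λ b → ¬ b ∈₂ (b₁ , b₂))
complementOfPair dne b₁≢b₂ =
  _ , _ , b₁≢b₂ , (λ k → k (inj₁ refl)) , (λ k → k (inj₂ refl)) , λ _ → dne

≢⇒Fin2↣ : {T : Set} {x y : T} → x ≢ y → Fin 2 ↣ T
≢⇒Fin2↣ {T} {x} {y} x≢y = mk↣ injective
  where
  pick : Fin 2 → T
  pick zero       = x
  pick (suc zero) = y

  injective : ∀ {i j} → pick i ≡ pick j → i ≡ j
  injective {zero}     {zero}     _ = refl
  injective {zero}     {suc zero} e = ⊥-elim (x≢y e)
  injective {suc zero} {zero}     e = ⊥-elim (x≢y (sym e))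
  injective {suc zero} {suc zero} _ = refl

Fin2↣⇒Fin4↣⊎Fin2 : {T : Set} → Fin 2 ↣ T → Fin 4 ↣ (T ⊎ Fin 2)
Fin2↣⇒Fin4↣⊎Fin2 f = (f ⊎-↣ ↣-id (Fin 2)) ↣-∘ ↔⇒↣ +↔⊎

v₀ : ∀ {n} → Fin (suc n)
v₀ = zero

v₁ : ∀ {n} → Fin (suc (suc n))
v₁ = suc zero

v₂ : ∀ {n} → Fin (suc (suc (suc n)))
v₂ = suc (suc zero)

v₃ : ∀ {n} → Fin (suc (suc (suc (suc n))))
v₃ = suc (suc (suc zero))

infix 30 ¬'_

¬'_ : ∀ {n} → Fm n → Fm n
¬' φ = φ ⇒ ff

-- In a galaxy the reflexive points are exactly those of B.
core : ∀ {n} → Fin n → Fm n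
core i = rel i i

misses : ∀ {n} → Fin n → Fin n → Fm n
misses i j = ¬' rel i j

coMissed : ∀ {n} → Fin n → Fin n → Fm n
coMissed i j = ∃' (misses v₀ (suc i) ∧ misses v₀ (suc j))

isApex : ∀ {n} → Fm (suc n)
isApex = core v₀ ∧ ∀' (coMissed v₀ v₁)

vertexCode : Fm 2
vertexCode = ∃' (isApex ∧ ∀' ((misses v₀ v₂ ∧ misses v₀ v₁) ⇒ (v₀ ≐ v₃)))

sameVertex : Fm 4
sameVertex = v₀ ≐ v₂

adjacent : Fm 4
adjacent = coMissed v₀ v₂ ∧ ¬' (v₀ ≐ v₂)

pattern vertex w = inj₁ w
pattern apex     = inj₂ zero
pattern base     = inj₂ (suc zero)

pattern copy w       = inj₁ (inj₁ w)
pattern edge a b a~b = inj₁ (inj₂ (a , b , a~b))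
pattern extra i      = inj₂ i

module GalaxyEncoding {W : Set} (R : W → W → Set)
  (dne : DoubleNegationElimination 0ℓ)
  (irreflexive : ∀ x → ¬ R x x) (symmetric : ∀ x y → R x y → R y x)
  (w₀ : W) where

  B : Set
  B = W ⊎ Fin 2

  A : Set
  A = (W ⊎ Σ[ a ∈ W ] Σ[ b ∈ W ] R a b) ⊎ Fin 2

  missed : A → B × B
  missed (copy w)     = vertex w , apex
  missed (edge a b _) = vertex a , vertex b
  missed (extra _)    = apex , base

  -- Since ρ s is a complement, a satellite not seeing b only yields
  -- ¬ ¬ (b ∈₂ missed s); this is where excluded middle is used.
  ρ : A → B → Set
  ρ s b = ¬ b ∈₂ missed s

  encoding : Frame
  encoding = galaxy A B ρ (inj₂ apex)

  Pt : Set
  Pt = A ⊎ B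

  GR : Pt → Pt → Set
  GR = galaxyRel A B ρ

  ⟦_⟧ : W → Pt
  ⟦ w ⟧ = inj₂ (vertex w)

  ⟦⟧-injective : ∀ {w w'} → ⟦ w ⟧ ≡ ⟦ w' ⟧ → w ≡ w'
  ⟦⟧-injective refl = refl

  R⇒≢ : ∀ {a b} → R a b → a ≢ b
  R⇒≢ {a} a~a refl = irreflexive a a~a

  missed-distinct : ∀ s → proj₁ (missed s) ≢ proj₂ (missed s)
  missed-distinct (copy _)       ()
  missed-distinct (edge _ _ a~b) e = R⇒≢ a~b (inj₁-injective e)
  missed-distinct (extra _)      ()

  missesFirst : ∀ s → ¬ GR (inj₁ s) (inj₂ (proj₁ (missed s)))
  missesFirst _ k = k (inj₁ refl)

  missesSecond : ∀ s → ¬ GR (inj₁ s) (inj₂ (proj₂ (missed s)))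
  missesSecond _ k = k (inj₂ refl)

  vertexOrMissedByExtras : ∀ x → (Σ[ w ∈ W ] x ≡ ⟦ w ⟧) ⊎ (∀ i → ¬ GR (inj₁ (extra i)) x)
  vertexOrMissedByExtras (inj₁ _)          = inj₂ λ _ ()
  vertexOrMissedByExtras (inj₂ (vertex w)) = inj₁ (w , refl)
  vertexOrMissedByExtras (inj₂ apex)       = inj₂ λ i → missesFirst (extra i)
  vertexOrMissedByExtras (inj₂ base)       = inj₂ λ i → missesSecond (extra i)

  vertexAndBaseNeverCoMissed : ∀ x {w} → ¬ GR x ⟦ w ⟧ → ¬ GR x (inj₂ base) → ⊥
  vertexAndBaseNeverCoMissed (inj₂ _) m _  = m tt
  vertexAndBaseNeverCoMissed (inj₁ s) m m' = apart s (dne m) (dne m')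
    where
    apart : ∀ s {w} → vertex w ∈₂ missed s → base ∈₂ missed s → ⊥
    apart (copy _)     _ (inj₁ ())
    apart (copy _)     _ (inj₂ ())
    apart (edge _ _ _) _ (inj₁ ())
    apart (edge _ _ _) _ (inj₂ ())
    apart (extra _)    (inj₁ ()) _
    apart (extra _)    (inj₂ ()) _

  onlyCopyMissesVertexAndApex : ∀ s {w} → vertex w ∈₂ missed s → apex ∈₂ missed s → s ≡ copy w
  onlyCopyMissesVertexAndApex (copy _)     (inj₁ refl) _ = refl
  onlyCopyMissesVertexAndApex (copy _)     (inj₂ ())   _
  onlyCopyMissesVertexAndApex (edge _ _ _) _ (inj₁ ())
  onlyCopyMissesVertexAndApex (edge _ _ _) _ (inj₂ ())
  onlyCopyMissesVertexAndApex (extra _)    (inj₁ ()) _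
  onlyCopyMissesVertexAndApex (extra _)    (inj₂ ()) _

  coMissedVertices⇒R : ∀ s {w w'} → vertex w ∈₂ missed s → vertex w' ∈₂ missed s → w ≢ w' → R w w'
  coMissedVertices⇒R (copy _)       (inj₁ refl) (inj₁ refl) w≢w' = ⊥-elim (w≢w' refl)
  coMissedVertices⇒R (copy _)       (inj₂ ())   _           _
  coMissedVertices⇒R (copy _)       _           (inj₂ ())   _
  coMissedVertices⇒R (edge _ _ a~b) (inj₁ refl) (inj₂ refl) _    = a~b
  coMissedVertices⇒R (edge a b a~b) (inj₂ refl) (inj₁ refl) _    = symmetric a b a~b
  coMissedVertices⇒R (edge _ _ _)   (inj₁ refl) (inj₁ refl) w≢w' = ⊥-elim (w≢w' refl)
  coMissedVertices⇒R (edge _ _ _)   (inj₂ refl) (inj₂ refl) w≢w' = ⊥-elim (w≢w' refl)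
  coMissedVertices⇒R (extra _)      (inj₁ ())   _           _
  coMissedVertices⇒R (extra _)      (inj₂ ())   _           _

  isApex-apex : ∀ {n} (e : Fin n → Pt) → Sat encoding (inj₂ apex ▸ e) isApex
  isApex-apex e = tt , coMissedWithApex
    where
    coMissedWithApex : ∀ d → Σ[ x ∈ Pt ] ¬ GR x d × ¬ GR x (inj₂ apex)
    coMissedWithApex d with vertexOrMissedByExtras d
    ... | inj₁ (w , refl) = inj₁ (copy w) , missesFirst (copy w) , missesSecond (copy w)
    ... | inj₂ byExtras   = inj₁ (extra zero) , byExtras zero , missesFirst (extra zero)

  isApex⇒apex : ∀ {n} c (e : Fin n → Pt) → Sat encoding (c ▸ e) isApex → c ≡ inj₂ apex
  isApex⇒apex (inj₁ _)          _ (() , _)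
  isApex⇒apex (inj₂ apex)       _ _ = refl
  isApex⇒apex (inj₂ (vertex w)) _ (_ , coMissedWith) with coMissedWith (inj₂ base)
  ... | x , m-base , m-w = ⊥-elim (vertexAndBaseNeverCoMissed x m-w m-base)
  isApex⇒apex (inj₂ base)       _ (_ , coMissedWith) with coMissedWith ⟦ w₀ ⟧
  ... | x , m-w , m-base = ⊥-elim (vertexAndBaseNeverCoMissed x m-w m-base)

  vertexCode-copy : ∀ w → Sat encoding (env2 ⟦ w ⟧ (inj₁ (copy w))) vertexCode
  vertexCode-copy w = inj₂ apex , isApex-apex (env2 ⟦ w ⟧ (inj₁ (copy w))) , onlyCopy
    where
    onlyCopy : ∀ x → ¬ GR x ⟦ w ⟧ × ¬ GR x (inj₂ apex) → x ≡ inj₁ (copy w)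
    onlyCopy (inj₂ _) (m , _)  = ⊥-elim (m tt)
    onlyCopy (inj₁ s) (m , m') = cong inj₁ (onlyCopyMissesVertexAndApex s (dne m) (dne m'))

  vertexCode⇒vertex : ∀ x₁ x₂ → Sat encoding (env2 x₁ x₂) vertexCode → Σ[ w ∈ W ] x₁ ≡ ⟦ w ⟧
  vertexCode⇒vertex x₁ x₂ (c , c-isApex , only-x₂)
    with isApex⇒apex c (env2 x₁ x₂) c-isApex | vertexOrMissedByExtras x₁
  ... | _    | inj₁ isVertex = isVertex
  ... | refl | inj₂ byExtras = case trans (extra≡x₂ zero) (sym (extra≡x₂ (suc zero))) of λ ()
    where
    extra≡x₂ : ∀ i → inj₁ (extra i) ≡ x₂
    extra≡x₂ i = only-x₂ (inj₁ (extra i)) (byExtras i , missesFirst (extra i))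

  adjacent⇔R : ∀ {x₁ y₁ w w'} x₂ y₂ → x₁ ≡ ⟦ w ⟧ → y₁ ≡ ⟦ w' ⟧ →
               Sat encoding (env4 x₁ x₂ y₁ y₂) adjacent ⇔ R w w'
  adjacent⇔R {w = w} {w'} x₂ y₂ refl refl = mk⇔ toR fromR
    where
    toR : Sat encoding (env4 ⟦ w ⟧ x₂ ⟦ w' ⟧ y₂) adjacent → R w w'
    toR ((inj₂ _ , m , _) , _)       = ⊥-elim (m tt)
    toR ((inj₁ s , m , m') , ⟦w⟧≢⟦w'⟧) =
      coMissedVertices⇒R s (dne m) (dne m') (λ w≡w' → ⟦w⟧≢⟦w'⟧ (cong ⟦_⟧ w≡w'))

    fromR : R w w' → Sat encoding (env4 ⟦ w ⟧ x₂ ⟦ w' ⟧ y₂) adjacent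
    fromR w~w' = (inj₁ s , missesFirst s , missesSecond s) ,
                 λ ⟦w⟧≡⟦w'⟧ → R⇒≢ w~w' (⟦⟧-injective ⟦w⟧≡⟦w'⟧)
      where
      s : A
      s = edge w w' w~w'

  encoding∈L2 : ∀ {x y : W} → x ≢ y → L2 encoding
  encoding∈L2 x≢y =
    A , B , ρ , inj₂ apex ,
    Fin2↣⇒Fin4↣⊎Fin2 (mk↣ inj₁-injective ↣-∘ ≢⇒Fin2↣ x≢y) ,
    Fin2↣⇒Fin4↣⊎Fin2 (≢⇒Fin2↣ x≢y) ,
    (λ s → complementOfPair dne (missed-distinct s)) ,
    refl

  open Interp encoding vertexCode sameVertex adjacent

  vertexOf : X → W
  vertexOf ((x₁ , x₂) , code) = proj₁ (vertexCode⇒vertex x₁ x₂ code)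

  vertexOf-spec : ∀ a → proj₁ (pr a) ≡ ⟦ vertexOf a ⟧
  vertexOf-spec ((x₁ , x₂) , code) = proj₂ (vertexCode⇒vertex x₁ x₂ code)

  quotientIso : QuotientIso X η S (frame W R w₀)
  quotientIso = vertexOf , kernel , surjective , homomorphic
    where
    kernel : ∀ a b → η a b ⇔ (vertexOf a ≡ vertexOf b)
    kernel a b = mk⇔
      (λ a~b → ⟦⟧-injective (trans (sym (vertexOf-spec a)) (trans a~b (vertexOf-spec b))))
      (λ a≡b → trans (vertexOf-spec a) (trans (cong ⟦_⟧ a≡b) (sym (vertexOf-spec b))))

    surjective : ∀ w → Σ[ a ∈ X ] vertexOf a ≡ w
    surjective w = a , ⟦⟧-injective (sym (vertexOf-spec a))
      where
      a : X
      a = (⟦ w ⟧ , inj₁ (copy w)) , vertexCode-copy w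

    homomorphic : ∀ a b → S a b ⇔ R (vertexOf a) (vertexOf b)
    homomorphic a b = adjacent⇔R (proj₂ (pr a)) (proj₂ (pr b)) (vertexOf-spec a) (vertexOf-spec b)

lemma48 : ExcludedMiddle 0ℓ → RelElemDefinable IrrSym2 L2
lemma48 em = vertexCode , sameVertex , adjacent , interpret
  where
  interpret : (F : Frame) → IrrSym2 F →
              Σ[ F' ∈ Frame ] L2 F' × GoodInterp F' vertexCode sameVertex adjacent F
  interpret (frame W R w₀) (irreflexive , symmetric , x , y , x≢y) =
    encoding , encoding∈L2 x≢y ,
    quotientIso⇒goodInterp encoding vertexCode sameVertex adjacent (frame W R w₀) quotientIso
    where open GalaxyEncoding R (em⇒dne em) irreflexive symmetric w₀
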